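{- Let $T$ be any finite rooted tree with root $r$, and let $(x_v;\mathsf{var}_v)_{v\in T}$ be any real numbers with $\mathsf{var}_v>0$ for all $v$. Let $(\widehat{x}_v;\widehat{\mathsf{var}}_v)_{v\in T}$ be the output of the procedure $\mathsf{TreePostProcessing}$ (described in the context) on this input. Then: (Consistency) for every internal node $v$, $\widehat{x}_v=\sum_{u\in\mathrm{child}(v)}\widehat{x}_u$; (Weighted root-to-leaf sum preservation) for every leaf $v$, $\sum_{u\in\mathrm{anc}(v)}\frac{x_u}{\mathsf{var}_u}=\sum_{u\in\mathrm{anc}(v)}\frac{\widehat{x}_u}{\mathsf{var}_u}$, where $\mathrm{anc}(v)$ is the set of nodes on the path from $v$ to $r$, inclusive of both.
   Context: For a node $v$, $\mathrm{child}(v)$ is its set of children and $\mathrm{parent}(v)$ its parent. $\mathsf{CombineEstimates}((x;a),(y;b))$ returns $(z;s)$ with $s=\frac{ab}{a+b}$ and $z=s\left(\frac{x}{a}+\frac{y}{b}\right)$. $\mathsf{TreePostProcessing}$ on input $(x_v;\mathsf{var}_v)_{v\in T}$: Bottom-up pass: for each leaf $v$, set $(z^{\Uparrow}_v;\mathsf{var}^{\Uparrow}_v)=(x_v;\mathsf{var}_v)$. For each internal node $v$, in order from largest to smallest depth, set $(z^{\uparrow}_v;\mathsf{var}^{\uparrow}_v)=\big(\sum_{u\in\mathrm{child}(v)}z^{\Uparrow}_u;\sum_{u\in\mathrm{child}(v)}\mathsf{var}^{\Uparrow}_u\big)$ and $(z^{\Uparrow}_v;\mathsf{var}^{\Uparrow}_v)=\mathsf{CombineEstimates}((x_v;\mathsf{var}_v),(z^{\uparrow}_v;\mathsf{var}^{\uparrow}_v))$.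 Top-down pass: for the root set $(\widehat{x}_r;\widehat{\mathsf{var}}_r)=(z^{\Uparrow}_r;\mathsf{var}^{\Uparrow}_r)$ and $(z^{\Downarrow}_r;\mathsf{var}^{\Downarrow}_r)=(x_r;\mathsf{var}_r)$. For each non-root node $v$, in order from smallest to largest depth, with $p=\mathrm{parent}(v)$: set $z^{\downarrow}_v=z^{\Downarrow}_p-\sum_{u\in\mathrm{child}(p)\setminus\{v\}}z^{\Uparrow}_u$, $\mathsf{var}^{\downarrow}_v=\mathsf{var}^{\Downarrow}_p+\sum_{u\in\mathrm{child}(p)\setminus\{v\}}\mathsf{var}^{\Uparrow}_u$; then $(\widehat{x}_v;\widehat{\mathsf{var}}_v)=\mathsf{CombineEstimates}((z^{\Uparrow}_v;\mathsf{var}^{\Uparrow}_v),(z^{\downarrow}_v;\mathsf{var}^{\downarrow}_v))$ and $(z^{\Downarrow}_v;\mathsf{var}^{\Downarrow}_v)=\mathsf{CombineEstimates}((x_v;\mathsf{var}_v),(z^{\downarrow}_v;\mathsf{var}^{\downarrow}_v))$. The output is $(\widehat{x}_v;\widehat{\mathsf{var}}_v)_{v\in T}$. -}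

module Defs where

open import Level using (Level; _⊔_; Lift) renaming (suc to lsuc)
open import Data.Unit using (⊤)
open import Data.Product using (_×_; _,_; proj₁; proj₂)
open import Data.List using (List; []; _∷_; _++_; [_]; map; concatMap; foldr)
open import Data.List.Relation.Unary.All using (All)
open import Relation.Nullary using (¬_)
open import Relation.Binary.Structures using (IsStrictPartialOrder)
open import Algebra.Bundles using (CommutativeRing)

-- Ordered fields (the reals are an instance).  The inverse is a total
-- function (value at 0 irrelevant); it is only ever used on positive
-- arguments by the algorithm below.

record OrderedField (c ℓ₁ ℓ₂ : Level) : Set (lsuc (c ⊔ ℓ₁ ⊔ ℓ₂)) where
  field
    commutativeRing : CommutativeRing c ℓ₁
  open CommutativeRing commutativeRing public
  infix 4 _<_
  infix 9 _⁻¹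
  field
    _<_                  : Carrier → Carrier → Set ℓ₂
    isStrictPartialOrder : IsStrictPartialOrder _≈_ _<_
    0<1                  : 0# < 1#
    +-monoˡ-<            : ∀ z {x y} → x < y → x + z < y + z
    *-pos                : ∀ {x y} → 0# < x → 0# < y → 0# < x * y
    _⁻¹                  : Carrier → Carrier
    ⁻¹-cong              : ∀ {x y} → x ≈ y → x ⁻¹ ≈ y ⁻¹
    ⁻¹-inverse           : ∀ x → ¬ (x ≈ 0#) → x * x ⁻¹ ≈ 1#

data Tree {a} (A : Set a) : Set a where
  node : A → List (Tree A) → Tree A

label : ∀ {a} {A : Set a} → Tree A → A
label (node x _) = x

mutual
  EveryNode : ∀ {a ℓ} {A : Set a} → (Tree A → Set ℓ) → Tree A → Set ℓ
  EveryNode P t@(node _ cs) = P t × EveryNodeList P cs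

  EveryNodeList : ∀ {a ℓ} {A : Set a} → (Tree A → Set ℓ) → List (Tree A) → Set ℓ
  EveryNodeList P []       = Lift _ ⊤
  EveryNodeList P (t ∷ ts) = EveryNode P t × EveryNodeList P ts

-- All root-to-leaf paths, each listed as the labels of the nodes on it
-- (i.e. the labels of anc(v) for each leaf v).
mutual
  paths : ∀ {a} {A : Set a} → Tree A → List (List A)
  paths (node x [])       = [ [ x ] ]
  paths (node x (c ∷ cs)) = map (x ∷_) (pathsList (c ∷ cs))

  pathsList : ∀ {a} {A : Set a} → List (Tree A) → List (List A)
  pathsList []       = []
  pathsList (t ∷ ts) = paths t ++ pathsList ts

module TreePP {c ℓ₁ ℓ₂} (F : OrderedField c ℓ₁ ℓ₂) where
  open OrderedField F

  Est : Set c
  Est = Carrier × Carrier          -- (value ; variance)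

  sumC : List Carrier → Carrier
  sumC = foldr _+_ 0#

  CombineEstimates : Est → Est → Est
  CombineEstimates (x , a) (y , b) =
    let s = (a * b) * (a + b) ⁻¹ in (s * (x * a ⁻¹ + y * b ⁻¹) , s)

  -- label after the bottom-up pass: input (x_v;var_v) and (z^⇑_v;var^⇑_v)
  record UpLabel : Set c where
    constructor mkUp
    field
      inp : Est
      upE : Est
  open UpLabel public

  record OutLabel : Set c where
    constructor mkOut
    field
      input  : Est
      output : Est
  open OutLabel public

  xOf varOf xhatOf varhatOf : OutLabel → Carrier
  xOf      o = proj₁ (input o)
  varOf    o = proj₂ (input o)
  xhatOf   o = proj₁ (output o)
  varhatOf o = proj₂ (output o)

  sumUpZ sumUpVar : List (Tree UpLabel) → Carrier
  sumUpZ   ts = sumC (map (λ t → proj₁ (upE (label t))) ts)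
  sumUpVar ts = sumC (map (λ t → proj₂ (upE (label t))) ts)

  mutual
    upPass : Tree Est → Tree UpLabel
    upPass (node e [])       = node (mkUp e e) []
    upPass (node e (c ∷ cs)) =
      let ts = upPassList (c ∷ cs) in
      node (mkUp e (CombineEstimates e (sumUpZ ts , sumUpVar ts))) ts

    upPassList : List (Tree Est) → List (Tree UpLabel)
    upPassList []       = []
    upPassList (t ∷ ts) = upPass t ∷ upPassList ts

  -- top-down pass.  downNode (z^⇓_p;var^⇓_p) others v  processes a
  -- non-root node v whose siblings (child(p) ∖ {v}) are 'others'.
  mutual
    downNode : Est → List (Tree UpLabel) → Tree UpLabel → Tree OutLabel
    downNode (zp , vp) others (node (mkUp e u) cs) =
      let d  = (zp + - sumUpZ others , vp + sumUpVar others)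
          dv = CombineEstimates e d
      in node (mkOut e (CombineEstimates u d)) (downChildren dv [] cs)

    downChildren : Est → List (Tree UpLabel) → List (Tree UpLabel) → List (Tree OutLabel)
    downChildren dp left []          = []
    downChildren dp left (t ∷ right) =
      downNode dp (left ++ right) t ∷ downChildren dp (left ++ [ t ]) right

  TreePostProcessing : Tree Est → Tree OutLabel
  TreePostProcessing t with upPass t
  ... | node (mkUp e u) cs = node (mkOut e u) (downChildren e [] cs)

  ConsistentAt : Tree OutLabel → Set ℓ₁
  ConsistentAt (node o [])       = Lift ℓ₁ ⊤
  ConsistentAt (node o (c ∷ cs)) =
    xhatOf o ≈ sumC (map (λ t → xhatOf (label t)) (c ∷ cs))

  WeightedSumPreserved : List OutLabel → Set ℓ₁
  WeightedSumPreserved p =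
    sumC (map (λ o → xOf o * varOf o ⁻¹) p) ≈ sumC (map (λ o → xhatOf o * varOf o ⁻¹) p)

-- CombineEstimates is addition in information form: (x;a) ⊕ (y;b) has
-- precision 1/a + 1/b and information x/a + y/b.  Hence x̂_v, obtained by
-- combining x_v, z↑_v and z↓_v in some order, is their precision-weighted mean,
-- and it may equally be computed as (z⇓_v;var⇓_v) ⊕ (z↑_v;var↑_v).  Writing
-- G_v = (z⇓_v − z↑_v)/(var⇓_v + var↑_v), every child u of v has
-- (z↓_u − z⇑_u)/(var↓_u + var⇑_u) = G_v, because z⇑_u and var⇑_u cancel between
-- z↓_u and z↑_v; so x̂_u = z⇑_u + var⇑_u G_v, and summing over the children gives
-- x̂_v = z↑_v + var↑_v G_v, which is consistency.  The weighted mean at v balances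
-- as x_v/var_v + G_{parent v} = x̂_v/var_v + G_v (with G = 0 above the root and
-- below the leaves), so the weighted sums along a root-to-leaf path telescope.
module Submission where

open import Defs
open import Data.Product using (_×_; proj₂)
open import Data.List.Relation.Unary.All using (All; []; _∷_)

open import Level using (0ℓ; _⊔_)
open import Function using (_∘_)
open import Data.Product using (_,_; proj₁)
open import Data.Nat as ℕ using (ℕ)
open import Data.Maybe using (Maybe; just; nothing)
open import Data.List using (List; []; _∷_; _++_; [_]; map)
import Data.List.Relation.Unary.All as All
import Data.List.Relation.Unary.All.Properties as All
open import Relation.Nullary using (yes; no)
open import Relation.Binary.PropositionalEquality as ≡ using (_≡_)
open import Relation.Binary.Structures using (IsStrictPartialOrder)
open import Algebra.Bundles using (CommutativeRing; RawRing)

-- Algebra.Solver.Ring needs a coefficient ring mapping homomorphically into the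
-- target; for an arbitrary commutative ring we take formal differences (m , n)
-- of naturals, read as m·1 − n·1.
module FormalDifferenceRingSolver {c ℓ} (R : CommutativeRing c ℓ) where
  open CommutativeRing R
  open import Algebra.Properties.Semiring.Mult semiring using (×-homo-+; ×1-homo-*) renaming (_×_ to _·_)
  open import Algebra.Properties.Ring ring using (x[y-z]≈xy-xz; [y-z]x≈yx-zx)
  open import Algebra.Properties.AbelianGroup +-abelianGroup using (⁻¹-∙-comm; ⁻¹-anti-homo‿-; ε⁻¹≈ε)
  open import Algebra.Properties.CommutativeSemigroup +-commutativeSemigroup using (interchange)
  open import Algebra.Solver.Ring.AlmostCommutativeRing
    using (AlmostCommutativeRing; fromCommutativeRing; _-Raw-AlmostCommutative⟶_)
  open import Relation.Binary.Reasoning.Setoid setoid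

  FormalDifference : RawRing 0ℓ 0ℓ
  FormalDifference = record
    { Carrier = ℕ × ℕ
    ; _≈_     = _≡_
    ; _+_     = λ { (a , b) (c , d) → (a ℕ.+ c , b ℕ.+ d) }
    ; _*_     = λ { (a , b) (c , d) → (a ℕ.* c ℕ.+ b ℕ.* d , a ℕ.* d ℕ.+ b ℕ.* c) }
    ; -_      = λ { (a , b) → (b , a) }
    ; 0#      = (0 , 0)
    ; 1#      = (1 , 0)
    }

  embed : ℕ × ℕ → Carrier
  embed (m , n) = m · 1# - n · 1#

  [a+c]-[b+d]≈[a-b]+[c-d] : ∀ a b c d → (a + c) - (b + d) ≈ (a - b) + (c - d)
  [a+c]-[b+d]≈[a-b]+[c-d] a b c d = begin
    (a + c) - (b + d)      ≈⟨ +-congˡ (⁻¹-∙-comm b d) ⟨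
    (a + c) + (- b + - d)  ≈⟨ interchange a c (- b) (- d) ⟩
    (a - b) + (c - d)      ∎

  ac+bd-[ad+bc]≈[a-b][c-d] : ∀ a b c d → (a * c + b * d) - (a * d + b * c) ≈ (a - b) * (c - d)
  ac+bd-[ad+bc]≈[a-b][c-d] a b c d = begin
    (a * c + b * d) - (a * d + b * c)    ≈⟨ [a+c]-[b+d]≈[a-b]+[c-d] (a * c) (a * d) (b * d) (b * c) ⟩
    (a * c - a * d) + (b * d - b * c)    ≈⟨ +-congˡ (⁻¹-anti-homo‿- (b * c) (b * d)) ⟨
    (a * c - a * d) - (b * c - b * d)    ≈⟨ +-cong (x[y-z]≈xy-xz a c d) (-‿cong (x[y-z]≈xy-xz b c d)) ⟨
    a * (c - d) - b * (c - d)            ≈⟨ [y-z]x≈yx-zx (c - d) a b ⟨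
    (a - b) * (c - d)                    ∎

  a+d≈c+b⇒a-b≈c-d : ∀ a b c d → a + d ≈ c + b → a - b ≈ c - d
  a+d≈c+b⇒a-b≈c-d a b c d a+d≈c+b = begin
    a - b                    ≈⟨ +-identityʳ (a - b) ⟨
    (a - b) + 0#             ≈⟨ +-congˡ (-‿inverseʳ d) ⟨
    (a - b) + (d - d)        ≈⟨ [a+c]-[b+d]≈[a-b]+[c-d] a b d d ⟨
    (a + d) - (b + d)        ≈⟨ +-cong a+d≈c+b (-‿cong (+-comm b d)) ⟩
    (c + b) - (d + b)        ≈⟨ [a+c]-[b+d]≈[a-b]+[c-d] c d b b ⟩
    (c - d) + (b - b)        ≈⟨ +-congˡ (-‿inverseʳ b) ⟩
    (c - d) + 0#             ≈⟨ +-identityʳ (c - d) ⟩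
    c - d                    ∎

  ACR : AlmostCommutativeRing c ℓ
  ACR = fromCommutativeRing R

  homomorphism : FormalDifference -Raw-AlmostCommutative⟶ ACR
  homomorphism = record
    { ⟦_⟧    = embed
    ; +-homo = λ { (a , b) (c , d) →
        trans (+-cong (×-homo-+ 1# a c) (-‿cong (×-homo-+ 1# b d)))
              ([a+c]-[b+d]≈[a-b]+[c-d] (a · 1#) (b · 1#) (c · 1#) (d · 1#)) }
    ; *-homo = λ { (a , b) (c , d) →
        trans (+-cong (·-homo-*+* a c b d) (-‿cong (·-homo-*+* a d b c)))
              (ac+bd-[ad+bc]≈[a-b][c-d] (a · 1#) (b · 1#) (c · 1#) (d · 1#)) }
    ; -‿homo = λ { (a , b) → sym (⁻¹-anti-homo‿- (a · 1#) (b · 1#)) }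
    ; 0-homo = -‿inverseʳ 0#
    ; 1-homo = trans (+-congˡ ε⁻¹≈ε) (trans (+-identityʳ _) (+-identityʳ 1#))
    }
    where
    ·-homo-*+* : ∀ a c b d → (a ℕ.* c ℕ.+ b ℕ.* d) · 1# ≈ a · 1# * c · 1# + b · 1# * d · 1#
    ·-homo-*+* a c b d = trans (×-homo-+ 1# (a ℕ.* c) (b ℕ.* d)) (+-cong (×1-homo-* a c) (×1-homo-* b d))

  equal? : ∀ x y → Maybe (embed x ≈ embed y)
  equal? (a , b) (c , d) with a ℕ.+ d ℕ.≟ c ℕ.+ b
  ... | yes a+d≡c+b = just (a+d≈c+b⇒a-b≈c-d (a · 1#) (b · 1#) (c · 1#) (d · 1#)
          (trans (sym (×-homo-+ 1# a d)) (trans (reflexive (≡.cong (_· 1#) a+d≡c+b)) (×-homo-+ 1# c b))))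
  ... | no _        = nothing

  open import Algebra.Solver.Ring FormalDifference ACR homomorphism equal? public

module OrderedFieldProperties {c ℓ₁ ℓ₂} (F : OrderedField c ℓ₁ ℓ₂) where
  open OrderedField F
  open TreePP F using (sumC)
  open IsStrictPartialOrder isStrictPartialOrder using (irrefl; <-resp-≈) renaming (trans to <-trans)
  open FormalDifferenceRingSolver commutativeRing using (solve; _:=_; _:+_; _:*_; _:-_)
  open import Relation.Binary.Reasoning.Setoid setoid

  0<x⇒x≉0 : ∀ {x} → 0# < x → x ≉ 0#
  0<x⇒x≉0 0<x x≈0 = irrefl refl (proj₁ <-resp-≈ x≈0 0<x)

  1≉0 : 1# ≉ 0#
  1≉0 = 0<x⇒x≉0 0<1

  +-pos : ∀ {x y} → 0# < x → 0# < y → 0# < x + y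
  +-pos {x} {y} 0<x 0<y = <-trans 0<y (proj₂ <-resp-≈ (+-identityˡ y) (+-monoˡ-< y 0<x))

  x≈1⇒x*y≈y : ∀ {x y} → x ≈ 1# → x * y ≈ y
  x≈1⇒x*y≈y x≈1 = trans (*-congʳ x≈1) (*-identityˡ _)

  x⁻¹[xy]≈y : ∀ {x} y → x ≉ 0# → x ⁻¹ * (x * y) ≈ y
  x⁻¹[xy]≈y {x} y x≉0 =
    trans (solve 3 (λ x x⁻¹ y → x⁻¹ :* (x :* y) := (x :* x⁻¹) :* y) refl x (x ⁻¹) y)
          (x≈1⇒x*y≈y (⁻¹-inverse x x≉0))

  xyx⁻¹≈y : ∀ {x} y → x ≉ 0# → x * y * x ⁻¹ ≈ y
  xyx⁻¹≈y {x} y x≉0 =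
    trans (solve 3 (λ x y x⁻¹ → x :* y :* x⁻¹ := x⁻¹ :* (x :* y)) refl x y (x ⁻¹)) (x⁻¹[xy]≈y y x≉0)

  x*y≈1⇒x⁻¹≈y : ∀ {x y} → x * y ≈ 1# → x ⁻¹ ≈ y
  x*y≈1⇒x⁻¹≈y {x} {y} xy≈1 = begin
    x ⁻¹              ≈⟨ *-identityʳ (x ⁻¹) ⟨
    x ⁻¹ * 1#         ≈⟨ *-congˡ xy≈1 ⟨
    x ⁻¹ * (x * y)    ≈⟨ x⁻¹[xy]≈y y x≉0 ⟩
    y                 ∎
    where
    x≉0 : x ≉ 0#
    x≉0 x≈0 = 1≉0 (trans (sym xy≈1) (trans (*-congʳ x≈0) (zeroˡ y)))

  x≈y+z*w⇒w≈[x-y]z⁻¹ : ∀ {x y z w} → z ≉ 0# → x ≈ y + z * w → w ≈ (x - y) * z ⁻¹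
  x≈y+z*w⇒w≈[x-y]z⁻¹ {x} {y} {z} {w} z≉0 x≈y+zw = sym (begin
    (x - y) * z ⁻¹            ≈⟨ *-congʳ (+-congʳ x≈y+zw) ⟩
    (y + z * w - y) * z ⁻¹    ≈⟨ solve 4 (λ y z w z⁻¹ → (y :+ z :* w :- y) :* z⁻¹ := z :* w :* z⁻¹)
                                         refl y z w (z ⁻¹) ⟩
    z * w * z ⁻¹              ≈⟨ xyx⁻¹≈y w z≉0 ⟩
    w                         ∎)

  x≈y*z⁻¹⇒x*z≈y : ∀ {x y z} → z ≉ 0# → x ≈ y * z ⁻¹ → x * z ≈ y
  x≈y*z⁻¹⇒x*z≈y {x} {y} {z} z≉0 x≈yz⁻¹ = begin
    x * z             ≈⟨ *-congʳ x≈yz⁻¹ ⟩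
    y * z ⁻¹ * z      ≈⟨ solve 3 (λ y z z⁻¹ → y :* z⁻¹ :* z := z :* y :* z⁻¹) refl y z (z ⁻¹) ⟩
    z * y * z ⁻¹      ≈⟨ xyx⁻¹≈y y z≉0 ⟩
    y                 ∎

  -- The order is only partial, so 0 < x does not yield 0 < x ⁻¹; positivity of
  -- variances is therefore tracked as being a quotient of positive elements.
  record PosRatio (x : Carrier) : Set (c ⊔ ℓ₁ ⊔ ℓ₂) where
    constructor posRatio
    field
      den num   : Carrier
      0<den     : 0# < den
      0<num     : 0# < num
      x*den≈num : x * den ≈ num

  pos⇒posRatio : ∀ {x} → 0# < x → PosRatio x
  pos⇒posRatio {x} 0<x = posRatio 1# x 0<1 0<x (*-identityʳ x)

  posRatio⇒≉0 : ∀ {x} → PosRatio x → x ≉ 0#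
  posRatio⇒≉0 (posRatio p q _ 0<q xp≈q) x≈0 =
    0<x⇒x≉0 0<q (trans (sym xp≈q) (trans (*-congʳ x≈0) (zeroˡ p)))

  posRatio⇒x*x⁻¹≈1 : ∀ {x} → PosRatio x → x * x ⁻¹ ≈ 1#
  posRatio⇒x*x⁻¹≈1 {x} x>0 = ⁻¹-inverse x (posRatio⇒≉0 x>0)

  posRatio-resp : ∀ {x y} → x ≈ y → PosRatio x → PosRatio y
  posRatio-resp x≈y (posRatio p q 0<p 0<q xp≈q) = posRatio p q 0<p 0<q (trans (*-congʳ (sym x≈y)) xp≈q)

  posRatio-+ : ∀ {x y} → PosRatio x → PosRatio y → PosRatio (x + y)
  posRatio-+ {x} {y} (posRatio p q 0<p 0<q xp≈q) (posRatio p′ q′ 0<p′ 0<q′ yp′≈q′) =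
    posRatio (p * p′) (q * p′ + q′ * p) (*-pos 0<p 0<p′) (+-pos (*-pos 0<q 0<p′) (*-pos 0<q′ 0<p))
      (trans (solve 4 (λ x y p p′ → (x :+ y) :* (p :* p′) := (x :* p) :* p′ :+ (y :* p′) :* p) refl x y p p′)
             (+-cong (*-congʳ xp≈q) (*-congʳ yp′≈q′)))

  posRatio-* : ∀ {x y} → PosRatio x → PosRatio y → PosRatio (x * y)
  posRatio-* {x} {y} (posRatio p q 0<p 0<q xp≈q) (posRatio p′ q′ 0<p′ 0<q′ yp′≈q′) =
    posRatio (p * p′) (q * q′) (*-pos 0<p 0<p′) (*-pos 0<q 0<q′)
      (trans (solve 4 (λ x y p p′ → (x :* y) :* (p :* p′) := (x :* p) :* (y :* p′)) refl x y p p′)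
             (*-cong xp≈q yp′≈q′))

  posRatio-⁻¹ : ∀ {x} → PosRatio x → PosRatio (x ⁻¹)
  posRatio-⁻¹ x>0@(posRatio p q 0<p 0<q xp≈q) =
    posRatio q p 0<q 0<p (trans (*-congˡ (sym xp≈q)) (x⁻¹[xy]≈y p (posRatio⇒≉0 x>0)))

  posRatio-+-sum : ∀ {x ys} → PosRatio x → All PosRatio ys → PosRatio (x + sumC ys)
  posRatio-+-sum x>0 []          = posRatio-resp (sym (+-identityʳ _)) x>0
  posRatio-+-sum x>0 (y>0 ∷ ys>0) = posRatio-+ x>0 (posRatio-+-sum y>0 ys>0)

module CombineEstimatesProperties {c ℓ₁ ℓ₂} (F : OrderedField c ℓ₁ ℓ₂) where
  open OrderedField F
  open TreePP F
  open OrderedFieldProperties F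
  open FormalDifferenceRingSolver commutativeRing using (solve; _:=_; _:+_; _:*_; :-_; _:-_)
  open import Algebra.Properties.CommutativeSemigroup +-commutativeSemigroup using (xy∙z≈xz∙y)
  open import Relation.Binary.Reasoning.Setoid setoid

  infixl 6 _⊕_
  _⊕_ : Est → Est → Est
  _⊕_ = CombineEstimates

  precision information : Est → Carrier
  precision   e = proj₂ e ⁻¹
  information e = proj₁ e * proj₂ e ⁻¹

  correction : Est → Est → Carrier
  correction e f = (proj₁ f - proj₁ e) * (proj₂ e + proj₂ f) ⁻¹

  PosVar : Est → Set (c ⊔ ℓ₁ ⊔ ℓ₂)
  PosVar e = PosRatio (proj₂ e)

  ⊕-posVar : ∀ e f → PosVar e → PosVar f → PosVar (e ⊕ f)
  ⊕-posVar _ _ a>0 b>0 = posRatio-* (posRatio-* a>0 b>0) (posRatio-⁻¹ (posRatio-+ a>0 b>0))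

  ⊕-variance*precision : ∀ e f → PosVar e → PosVar f →
                         proj₂ (e ⊕ f) * (precision e + precision f) ≈ 1#
  ⊕-variance*precision (_ , a) (_ , b) a>0 b>0 = begin
    a * b * i * (a ⁻¹ + b ⁻¹)
      ≈⟨ solve 5 (λ a b i a⁻¹ b⁻¹ → a :* b :* i :* (a⁻¹ :+ b⁻¹)
                                  := (a :* a⁻¹) :* (b :* i) :+ (b :* b⁻¹) :* (a :* i))
                 refl a b i (a ⁻¹) (b ⁻¹) ⟩
    (a * a ⁻¹) * (b * i) + (b * b ⁻¹) * (a * i)
      ≈⟨ +-cong (x≈1⇒x*y≈y (posRatio⇒x*x⁻¹≈1 a>0)) (x≈1⇒x*y≈y (posRatio⇒x*x⁻¹≈1 b>0)) ⟩
    b * i + a * i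
      ≈⟨ solve 3 (λ a b i → b :* i :+ a :* i := (a :+ b) :* i) refl a b i ⟩
    (a + b) * i
      ≈⟨ posRatio⇒x*x⁻¹≈1 (posRatio-+ a>0 b>0) ⟩
    1#
      ∎
    where i = (a + b) ⁻¹

  ⊕-precision : ∀ e f → PosVar e → PosVar f → precision (e ⊕ f) ≈ precision e + precision f
  ⊕-precision e f e>0 f>0 = x*y≈1⇒x⁻¹≈y (⊕-variance*precision e f e>0 f>0)

  ⊕-variance : ∀ e f → PosVar e → PosVar f → proj₂ (e ⊕ f) ≈ (precision e + precision f) ⁻¹
  ⊕-variance e f e>0 f>0 = sym (x*y≈1⇒x⁻¹≈y (trans (*-comm _ _) (⊕-variance*precision e f e>0 f>0)))

  ⊕-information : ∀ e f → PosVar e → PosVar f → information (e ⊕ f) ≈ information e + information f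
  ⊕-information e f e>0 f>0 =
    xyx⁻¹≈y (information e + information f) (posRatio⇒≉0 (⊕-posVar e f e>0 f>0))

  ⊕-comm-value : ∀ e f → proj₁ (e ⊕ f) ≈ proj₁ (f ⊕ e)
  ⊕-comm-value (x , a) (y , b) = begin
    a * b * (a + b) ⁻¹ * (x * a ⁻¹ + y * b ⁻¹)
      ≈⟨ solve 7 (λ a b i x a⁻¹ y b⁻¹ → a :* b :* i :* (x :* a⁻¹ :+ y :* b⁻¹)
                                      := b :* a :* i :* (y :* b⁻¹ :+ x :* a⁻¹))
                 refl a b ((a + b) ⁻¹) x (a ⁻¹) y (b ⁻¹) ⟩
    b * a * (a + b) ⁻¹ * (y * b ⁻¹ + x * a ⁻¹)
      ≈⟨ *-congʳ (*-congˡ (⁻¹-cong (+-comm a b))) ⟩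
    b * a * (b + a) ⁻¹ * (y * b ⁻¹ + x * a ⁻¹)
      ∎

  ⊕-value-left : ∀ e f → PosVar e → PosVar f → proj₁ (e ⊕ f) ≈ proj₁ e + proj₂ e * correction e f
  ⊕-value-left (x , a) (y , b) a>0 b>0 = begin
    a * b * i * (x * a ⁻¹ + y * b ⁻¹)
      ≈⟨ solve 7 (λ a b i x a⁻¹ y b⁻¹ → a :* b :* i :* (x :* a⁻¹ :+ y :* b⁻¹)
                                      := (a :* a⁻¹) :* (b :* i :* x) :+ (b :* b⁻¹) :* (a :* i :* y))
                 refl a b i x (a ⁻¹) y (b ⁻¹) ⟩
    (a * a ⁻¹) * (b * i * x) + (b * b ⁻¹) * (a * i * y)
      ≈⟨ +-cong (x≈1⇒x*y≈y (posRatio⇒x*x⁻¹≈1 a>0)) (x≈1⇒x*y≈y (posRatio⇒x*x⁻¹≈1 b>0)) ⟩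
    b * i * x + a * i * y
      ≈⟨ solve 5 (λ a b i x y → b :* i :* x :+ a :* i :* y := (a :+ b) :* i :* x :+ a :* ((y :- x) :* i))
                 refl a b i x y ⟩
    (a + b) * i * x + a * ((y - x) * i)
      ≈⟨ +-congʳ (x≈1⇒x*y≈y (posRatio⇒x*x⁻¹≈1 (posRatio-+ a>0 b>0))) ⟩
    x + a * ((y - x) * i)
      ∎
    where i = (a + b) ⁻¹

  correction-antisym : ∀ e f → correction e f ≈ - correction f e
  correction-antisym (x , a) (y , b) = begin
    (y - x) * (a + b) ⁻¹       ≈⟨ *-congˡ (⁻¹-cong (+-comm a b)) ⟩
    (y - x) * (b + a) ⁻¹       ≈⟨ solve 3 (λ x y i → (y :- x) :* i := :- ((x :- y) :* i))
                                          refl x y ((b + a) ⁻¹) ⟩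
    - ((x - y) * (b + a) ⁻¹)   ∎

  correction-left : ∀ e f → PosVar e → PosVar f → correction e f ≈ (proj₁ (e ⊕ f) - proj₁ e) * precision e
  correction-left e f e>0 f>0 = x≈y+z*w⇒w≈[x-y]z⁻¹ (posRatio⇒≉0 e>0) (⊕-value-left e f e>0 f>0)

  correction-right : ∀ e f → PosVar e → PosVar f → correction e f ≈ (proj₁ f - proj₁ (e ⊕ f)) * precision f
  correction-right e f e>0 f>0 = begin
    correction e f                                  ≈⟨ correction-antisym e f ⟩
    - correction f e                                ≈⟨ -‿cong (correction-left f e f>0 e>0) ⟩
    - ((proj₁ (f ⊕ e) - proj₁ f) * precision f)     ≈⟨ -‿cong (*-congʳ (+-congʳ (⊕-comm-value f e))) ⟩
    - ((proj₁ (e ⊕ f) - proj₁ f) * precision f)     ≈⟨ solve 3 (λ v y β → :- ((v :- y) :* β) := (y :- v) :* β)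
                                                                refl (proj₁ (e ⊕ f)) (proj₁ f) (precision f) ⟩
    (proj₁ f - proj₁ (e ⊕ f)) * precision f         ∎

  ⊕⊕-value : ∀ e f g → PosVar e → PosVar f → PosVar g →
             proj₁ (e ⊕ f ⊕ g)
               ≈ (information e + information f + information g) * (precision e + precision f + precision g) ⁻¹
  ⊕⊕-value e f g e>0 f>0 g>0 = begin
    proj₁ (e ⊕ f ⊕ g)
      ≈⟨ *-cong (⊕-variance (e ⊕ f) g (⊕-posVar e f e>0 f>0) g>0) (+-congʳ (⊕-information e f e>0 f>0)) ⟩
    (precision (e ⊕ f) + precision g) ⁻¹ * (information e + information f + information g)
      ≈⟨ *-congʳ (⁻¹-cong (+-congʳ (⊕-precision e f e>0 f>0))) ⟩
    (precision e + precision f + precision g) ⁻¹ * (information e + information f + information g)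
      ≈⟨ *-comm _ _ ⟩
    (information e + information f + information g) * (precision e + precision f + precision g) ⁻¹
      ∎

  ⊕-swap : ∀ e f g → PosVar e → PosVar f → PosVar g → proj₁ (e ⊕ f ⊕ g) ≈ proj₁ (f ⊕ (e ⊕ g))
  ⊕-swap e f g e>0 f>0 g>0 = begin
    proj₁ (e ⊕ f ⊕ g)
      ≈⟨ ⊕⊕-value e f g e>0 f>0 g>0 ⟩
    (information e + information f + information g) * (precision e + precision f + precision g) ⁻¹
      ≈⟨ *-cong (xy∙z≈xz∙y _ _ _) (⁻¹-cong (xy∙z≈xz∙y _ _ _)) ⟩
    (information e + information g + information f) * (precision e + precision g + precision f) ⁻¹
      ≈⟨ ⊕⊕-value e g f e>0 g>0 f>0 ⟨
    proj₁ (e ⊕ g ⊕ f)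
      ≈⟨ ⊕-comm-value (e ⊕ g) f ⟩
    proj₁ (f ⊕ (e ⊕ g))
      ∎

  leaf-balance : ∀ e d → PosVar e → PosVar d →
                 information e + correction e d ≈ proj₁ (e ⊕ d) * precision e
  leaf-balance e d e>0 d>0 = begin
    proj₁ e * α + correction e d                   ≈⟨ +-congˡ (correction-left e d e>0 d>0) ⟩
    proj₁ e * α + (proj₁ (e ⊕ d) - proj₁ e) * α    ≈⟨ solve 3 (λ x v α → x :* α :+ (v :- x) :* α := v :* α)
                                                              refl (proj₁ e) (proj₁ (e ⊕ d)) α ⟩
    proj₁ (e ⊕ d) * α                              ∎
    where α = precision e

  root-balance : ∀ e s → PosVar e → PosVar s →
                 information e ≈ proj₁ (e ⊕ s) * precision e + correction s e
  root-balance e s e>0 s>0 = begin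
    proj₁ e * α                                        ≈⟨ solve 3 (λ x v α → x :* α := v :* α :+ (x :- v) :* α)
                                                                  refl (proj₁ e) (proj₁ (e ⊕ s)) α ⟩
    proj₁ (e ⊕ s) * α + (proj₁ e - proj₁ (e ⊕ s)) * α  ≈⟨ +-congˡ (*-congʳ (+-congˡ
                                                            (-‿cong (⊕-comm-value e s)))) ⟩
    proj₁ (e ⊕ s) * α + (proj₁ e - proj₁ (s ⊕ e)) * α  ≈⟨ +-congˡ (correction-right s e s>0 e>0) ⟨
    proj₁ (e ⊕ s) * α + correction s e                 ∎
    where α = precision e

  root-consistency : ∀ e s → PosVar e → PosVar s →
                     proj₁ (e ⊕ s) ≈ proj₁ s + proj₂ s * correction s e
  root-consistency e s e>0 s>0 = trans (⊕-comm-value e s) (⊕-value-left s e s>0 e>0)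

  internal-balance : ∀ e s d → PosVar e → PosVar s → PosVar d →
                     information e + correction (e ⊕ s) d
                       ≈ proj₁ (e ⊕ s ⊕ d) * precision e + correction s (e ⊕ d)
  internal-balance e s d e>0 s>0 d>0 = begin
    x * α + correction (e ⊕ s) d
      ≈⟨ +-congˡ (correction-right (e ⊕ s) d (⊕-posVar e s e>0 s>0) d>0) ⟩
    x * α + (z - x̂) * β
      ≈⟨ solve 7 (λ x α z β x̂ S γ → x :* α :+ (z :- x̂) :* β
                                  := x :* α :+ S :* γ :+ z :* β :- x̂ :* β :- S :* γ)
                 refl x α z β x̂ S γ ⟩
    x * α + S * γ + z * β - x̂ * β - S * γ
      ≈⟨ +-congʳ (+-congʳ (sym x̂-mean)) ⟩
    x̂ * (α + γ + β) - x̂ * β - S * γ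
      ≈⟨ solve 5 (λ α β γ x̂ S → x̂ :* (α :+ γ :+ β) :- x̂ :* β :- S :* γ
                              := x̂ :* α :+ (x̂ :- S) :* γ)
                 refl α β γ x̂ S ⟩
    x̂ * α + (x̂ - S) * γ
      ≈⟨ +-congˡ (*-congʳ (+-congʳ (⊕-swap e s d e>0 s>0 d>0))) ⟩
    x̂ * α + (proj₁ (s ⊕ (e ⊕ d)) - S) * γ
      ≈⟨ +-congˡ (correction-left s (e ⊕ d) s>0 (⊕-posVar e d e>0 d>0)) ⟨
    x̂ * α + correction s (e ⊕ d)
      ∎
    where
    x = proj₁ e
    S = proj₁ s
    z = proj₁ d
    α = precision e
    γ = precision s
    β = precision d
    x̂ = proj₁ (e ⊕ s ⊕ d)
    x̂-mean : x̂ * (α + γ + β) ≈ x * α + S * γ + z * β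
    x̂-mean = x≈y*z⁻¹⇒x*z≈y
      (posRatio⇒≉0 (posRatio-+ (posRatio-+ (posRatio-⁻¹ e>0) (posRatio-⁻¹ s>0)) (posRatio-⁻¹ d>0)))
      (⊕⊕-value e s d e>0 s>0 d>0)

  internal-consistency : ∀ e s d → PosVar e → PosVar s → PosVar d →
                         proj₁ (e ⊕ s ⊕ d) ≈ proj₁ s + proj₂ s * correction s (e ⊕ d)
  internal-consistency e s d e>0 s>0 d>0 =
    trans (⊕-swap e s d e>0 s>0 d>0) (⊕-value-left s (e ⊕ d) s>0 (⊕-posVar e d e>0 d>0))

  correction-sibling : ∀ z v S V D Dv So Vo → So + z ≈ S → Vo + v ≈ V →
                       correction (z , v) (D - So , Dv + Vo) ≈ correction (S , V) (D , Dv)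
  correction-sibling z v S V D Dv So Vo So+z≈S Vo+v≈V = *-cong difference (⁻¹-cong variance)
    where
    difference : D - So - z ≈ D - S
    difference = trans (solve 3 (λ D So z → D :- So :- z := D :- (So :+ z)) refl D So z) (+-congˡ (-‿cong So+z≈S))
    variance : v + (Dv + Vo) ≈ V + Dv
    variance = trans (solve 3 (λ v Dv Vo → v :+ (Dv :+ Vo) := Vo :+ v :+ Dv) refl v Dv Vo) (+-congʳ Vo+v≈V)

module TreePostProcessingProperties {c ℓ₁ ℓ₂} (F : OrderedField c ℓ₁ ℓ₂) where
  open OrderedField F
  open TreePP F
  open OrderedFieldProperties F
  open CombineEstimatesProperties F
  open FormalDifferenceRingSolver commutativeRing using (solve; _:=_; _:+_; _:*_)
  open import Relation.Binary.Reasoning.Setoid setoid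

  0<variance : Tree Est → Set ℓ₂
  0<variance t = 0# < proj₂ (label t)

  upEst : Tree UpLabel → Est
  upEst t = upE (label t)

  total : List (Tree UpLabel) → Est
  total ts = (sumUpZ ts , sumUpVar ts)

  -- (z↓_v;var↓_v) for a node v with siblings others, when p is (z⇓;var⇓) of its parent.
  incoming : Est → List (Tree UpLabel) → Est
  incoming p others = (proj₁ p - sumUpZ others , proj₂ p + sumUpVar others)

  downNode-output : ∀ p others t → output (label (downNode p others t)) ≡ upEst t ⊕ incoming p others
  downNode-output p others (node _ _) = ≡.refl

  sumC-map-++ : ∀ {a} {A : Set a} (f : A → Carrier) xs ys →
                sumC (map f (xs ++ ys)) ≈ sumC (map f xs) + sumC (map f ys)
  sumC-map-++ f []       ys = sym (+-identityˡ _)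
  sumC-map-++ f (x ∷ xs) ys = trans (+-congˡ (sumC-map-++ f xs ys)) (sym (+-assoc _ _ _))

  sumC-map-sibling : ∀ {a} {A : Set a} (f : A → Carrier) left t ts {S} →
                     sumC (map f left) + sumC (map f (t ∷ ts)) ≈ S →
                     (sumC (map f (left ++ ts)) + f t ≈ S)
                     × (sumC (map f (left ++ [ t ])) + sumC (map f ts) ≈ S)
  sumC-map-sibling f left t ts L+tT≈S =
      trans (+-congʳ (sumC-map-++ f left ts))
            (trans (solve 3 (λ L T x → L :+ T :+ x := L :+ (x :+ T)) refl L T (f t)) L+tT≈S)
    , trans (+-congʳ (trans (sumC-map-++ f left [ t ]) (+-congˡ (+-identityʳ (f t)))))
            (trans (+-assoc L (f t) T) L+tT≈S)
    where
    L = sumC (map f left)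
    T = sumC (map f ts)

  +-sumUpVar-posRatio : ∀ {x} ts → PosRatio x → All (PosVar ∘ upEst) ts → PosRatio (x + sumUpVar ts)
  +-sumUpVar-posRatio ts x>0 ts>0 = posRatio-+-sum x>0 (All.map⁺ ts>0)

  mutual
    upPass-posVar : ∀ t → EveryNode 0<variance t → PosVar (upEst (upPass t))
    upPass-posVar (node e [])       (0<a , _)  = pos⇒posRatio 0<a
    upPass-posVar (node e (c ∷ cs)) (0<a , ps) =
      ⊕-posVar e (total (upPassList (c ∷ cs))) (pos⇒posRatio 0<a) (total-posVar c cs ps)

    total-posVar : ∀ t ts → EveryNodeList 0<variance (t ∷ ts) → PosVar (total (upPassList (t ∷ ts)))
    total-posVar t ts (pt , pts) =
      +-sumUpVar-posRatio (upPassList ts) (upPass-posVar t pt) (upPassList-posVar ts pts)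

    upPassList-posVar : ∀ ts → EveryNodeList 0<variance ts → All (PosVar ∘ upEst) (upPassList ts)
    upPassList-posVar []       _          = []
    upPassList-posVar (t ∷ ts) (pt , pts) = upPass-posVar t pt ∷ upPassList-posVar ts pts

  record WeightedSumOffset (g : Carrier) (p : List OutLabel) : Set ℓ₁ where
    constructor offset
    field
      weighted-sums : sumC (map (λ o → xOf o * varOf o ⁻¹) p) + g
                        ≈ sumC (map (λ o → xhatOf o * varOf o ⁻¹) p)

  offset-[] : WeightedSumOffset 0# []
  offset-[] = offset (+-identityʳ 0#)

  offset-∷ : ∀ {o g h p} → xOf o * varOf o ⁻¹ + g ≈ xhatOf o * varOf o ⁻¹ + h →
             WeightedSumOffset h p → WeightedSumOffset g (o ∷ p)
  offset-∷ {o} {g} {h} {p} balance (offset sums) = offset (begin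
    x + X + g     ≈⟨ solve 3 (λ x X g → x :+ X :+ g := x :+ g :+ X) refl x X g ⟩
    x + g + X     ≈⟨ +-congʳ balance ⟩
    x̂ + h + X     ≈⟨ solve 3 (λ x̂ X h → x̂ :+ h :+ X := x̂ :+ (X :+ h)) refl x̂ X h ⟩
    x̂ + (X + h)   ≈⟨ +-congˡ sums ⟩
    x̂ + X̂         ∎)
    where
    x  = xOf o * varOf o ⁻¹
    x̂  = xhatOf o * varOf o ⁻¹
    X  = sumC (map (λ o → xOf o * varOf o ⁻¹) p)
    X̂  = sumC (map (λ o → xhatOf o * varOf o ⁻¹) p)

  offset-resp : ∀ {g h p} → g ≈ h → WeightedSumOffset g p → WeightedSumOffset h p
  offset-resp g≈h (offset sums) = offset (trans (+-congˡ (sym g≈h)) sums)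

  offset-0⇒preserved : ∀ {p} → WeightedSumOffset 0# p → WeightedSumPreserved p
  offset-0⇒preserved (offset sums) = trans (sym (+-identityʳ _)) sums

  DownInvariant : Tree Est → Set (c ⊔ ℓ₁ ⊔ ℓ₂)
  DownInvariant t = ∀ p others → PosVar (incoming p others) →
    EveryNode ConsistentAt (downNode p others (upPass t))
    × All (WeightedSumOffset (correction (upEst (upPass t)) (incoming p others))) (paths (downNode p others (upPass t)))

  -- All children of a node share one correction: that of (z↑_v;var↑_v)
  -- towards (z⇓_v;var⇓_v).  Here s is (z↑_v;var↑_v) and p is (z⇓_v;var⇓_v).
  siblings-correct : ∀ rs → EveryNodeList 0<variance rs → All DownInvariant rs →
    ∀ p left s → PosVar p → All (PosVar ∘ upEst) left →
    sumUpZ left + sumUpZ (upPassList rs) ≈ proj₁ s → sumUpVar left + sumUpVar (upPassList rs) ≈ proj₂ s →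
    EveryNodeList ConsistentAt (downChildren p left (upPassList rs))
    × sumC (map (λ t → xhatOf (label t)) (downChildren p left (upPassList rs)))
        ≈ sumUpZ (upPassList rs) + sumUpVar (upPassList rs) * correction s p
    × All (WeightedSumOffset (correction s p)) (pathsList (downChildren p left (upPassList rs)))
  siblings-correct [] _ _ p left s _ _ _ _ =
    _ , sym (trans (+-congˡ (zeroˡ _)) (+-identityʳ 0#)) , []
  siblings-correct (r ∷ rs) (pr , prs) (r-invariant ∷ rs-invariant) p left s p>0 left>0 z-sums v-sums =
      (proj₁ r-correct , proj₁ rest)
    , sum-x̂
    , All.++⁺ (All.map (offset-resp correction≈G) (proj₂ r-correct)) (proj₂ (proj₂ rest))
    where
    t      = upPass r
    ts     = upPassList rs
    z      = proj₁ (upEst t)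
    v      = proj₂ (upEst t)
    G      = correction s p
    others = left ++ ts
    t>0    = upPass-posVar r pr
    in>0   = +-sumUpVar-posRatio others p>0 (All.++⁺ left>0 (upPassList-posVar rs prs))
    z-split = sumC-map-sibling (λ t → proj₁ (upEst t)) left t ts z-sums
    v-split = sumC-map-sibling (λ t → proj₂ (upEst t)) left t ts v-sums
    r-correct = r-invariant p others in>0
    rest = siblings-correct rs prs rs-invariant p (left ++ [ t ]) s p>0 (All.++⁺ left>0 (t>0 ∷ []))
             (proj₂ z-split) (proj₂ v-split)

    correction≈G : correction (upEst t) (incoming p others) ≈ G
    correction≈G = correction-sibling z v (proj₁ s) (proj₂ s) (proj₁ p) (proj₂ p)
                     (sumUpZ others) (sumUpVar others) (proj₁ z-split) (proj₁ v-split)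

    x̂-t : xhatOf (label (downNode p others t)) ≈ z + v * G
    x̂-t = begin
      xhatOf (label (downNode p others t))   ≡⟨ ≡.cong proj₁ (downNode-output p others t) ⟩
      proj₁ (upEst t ⊕ incoming p others)    ≈⟨ ⊕-value-left (upEst t) (incoming p others) t>0 in>0 ⟩
      z + v * correction (upEst t) (incoming p others)  ≈⟨ +-congˡ (*-congˡ correction≈G) ⟩
      z + v * G                              ∎

    sum-x̂ : xhatOf (label (downNode p others t))
              + sumC (map (λ t → xhatOf (label t)) (downChildren p (left ++ [ t ]) ts))
            ≈ z + sumUpZ ts + (v + sumUpVar ts) * G
    sum-x̂ = trans (+-cong x̂-t (proj₁ (proj₂ rest)))
                  (solve 5 (λ z v T V G → z :+ v :* G :+ (T :+ V :* G) := z :+ T :+ (v :+ V) :* G)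
                         refl z v (sumUpZ ts) (sumUpVar ts) G)

  mutual
    downNode-correct : ∀ t → EveryNode 0<variance t → DownInvariant t
    downNode-correct (node e []) (0<a , _) p others d>0 =
      _ , offset-∷ (trans (leaf-balance e d (pos⇒posRatio 0<a) d>0) (sym (+-identityʳ _))) offset-[] ∷ []
      where d = incoming p others
    downNode-correct (node e (c ∷ cs)) (0<a , ps@(pc , pcs)) p others d>0 =
        (trans (internal-consistency e s d e>0 s>0 d>0) (sym (proj₁ (proj₂ children))) , proj₁ children)
      , All.map⁺ (All.map (offset-∷ (internal-balance e s d e>0 s>0 d>0)) (proj₂ (proj₂ children)))
      where
      d   = incoming p others
      s   = total (upPassList (c ∷ cs))
      e>0 = pos⇒posRatio 0<a
      s>0 = total-posVar c cs ps
      -- c and cs are passed separately: c ∷ cs rebuilt here is not seen as a subterm.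
      children = siblings-correct (c ∷ cs) ps (downNode-correct c pc ∷ all-downNode-correct cs pcs)
                   (e ⊕ d) [] s (⊕-posVar e d e>0 d>0) [] (+-identityˡ _) (+-identityˡ _)

    all-downNode-correct : ∀ ts → EveryNodeList 0<variance ts → All DownInvariant ts
    all-downNode-correct []       _          = []
    all-downNode-correct (t ∷ ts) (pt , pts) = downNode-correct t pt ∷ all-downNode-correct ts pts

  treePostProcessing-correct : ∀ T → EveryNode 0<variance T →
    EveryNode ConsistentAt (TreePostProcessing T) × All WeightedSumPreserved (paths (TreePostProcessing T))
  treePostProcessing-correct (node e [])       _          = _ , refl ∷ []
  treePostProcessing-correct (node e (c ∷ cs)) (0<a , ps) =
      (trans (root-consistency e s e>0 s>0) (sym (proj₁ (proj₂ children))) , proj₁ children)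
    , All.map⁺ (All.map (λ path → offset-0⇒preserved (offset-∷ {mkOut e (e ⊕ s)} balance path))
                        (proj₂ (proj₂ children)))
    where
    s   = total (upPassList (c ∷ cs))
    e>0 = pos⇒posRatio 0<a
    s>0 = total-posVar c cs ps
    balance = trans (+-identityʳ _) (root-balance e s e>0 s>0)
    children = siblings-correct (c ∷ cs) ps (all-downNode-correct (c ∷ cs) ps)
                 e [] s e>0 [] (+-identityˡ _) (+-identityˡ _)

lemma4p2 : ∀ {c ℓ₁ ℓ₂} (F : OrderedField c ℓ₁ ℓ₂) →
    let open OrderedField F in
    let open TreePP F in
    (T : Tree Est) → EveryNode (λ t → 0# < proj₂ (label t)) T →
    EveryNode ConsistentAt (TreePostProcessing T)
    × All WeightedSumPreserved (paths (TreePostProcessing T))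
lemma4p2 F = TreePostProcessingProperties.treePostProcessing-correct F
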